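{- Let $\overrightarrow{G}=\overrightarrow{G}(U\cup W,E)$ be a thin 2-qBMG with color classes $U$ and $W$. If $\overrightarrow{G}$ is balanced (i.e. $|U|=|W|$) and both $U$ and $W$ are $\mathrm{Aut}_I(\overrightarrow{G})$-orbits, then $E$ is either the union of pairwise vertex-disjoint edges or the union of pairwise vertex-disjoint symmetric edges, and $\mathrm{Aut}_I(\overrightarrow{G})\cong\mathrm{Sym}_n$ with $n=|U|=|W|$.
   Context: A digraph $\overrightarrow{G}=\overrightarrow{G}(V,E)$ has a finite vertex set $V$ and edge set $E\subseteq V\times V$ without loops ($uv$ denotes the edge with tail $u$ and head $v$); a symmetric edge is a pair $uv,vu\in E$. $N^+(v)=\{w:vw\in E\}$, $N^-(v)=\{w:wv\in E\}$. Two vertices $u,v$ are independent if neither $uv$ nor $vu$ is in $E$. A 2-qBMG is a digraph, equipped with a partition $V=U\cup W$ into two color classes such that every edge joins a vertex of $U$ and a vertex of $W$, satisfying: (N1) if $u,v$ are independent then there are no vertices $w,t$ with $ut,vw,tw\in E$; (N2) if $uv,vw,wt\in E$ then $ut\in E$; (N3) if $u,v$ have a common out-neighbor then $N^+(u)\subseteq N^+(v)$ or $N^+(v)\subseteq N^+(u)$. The digraph is thin if no two distinct vertices $x,y$ satisfy both $N^+(x)=N^+(y)$ and $N^-(x)=N^-(y)$. An automorphism is a permutation $\pi$ of $V$ with $xy\in E\Rightarrow\pi(x)\pi(y)\in E$; $\mathrm{Aut}_I(\overrightarrow{G})$ is the group of automorphisms mapping $U$ to $U$ and $W$ to $W$.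 $\mathrm{Sym}_n$ is the symmetric group on $n$ letters. -}

module Defs where

open import Data.Nat using (ℕ)
open import Data.Bool using (Bool; true; false; not)
open import Data.Fin using (Fin)
open import Data.Fin.Subset using (Subset; ∣_∣)
open import Data.Fin.Permutation using (Permutation′; _⟨$⟩ʳ_; _∘ₚ_)
open import Data.Vec using (tabulate)
open import Data.Product using (Σ; ∃; ∃-syntax; _×_; _,_; proj₁; proj₂)
open import Data.Sum using (_⊎_)
open import Data.Empty using (⊥)
open import Function using (_∘_; _⇔_)
open import Relation.Nullary using (¬_)
open import Relation.Binary.PropositionalEquality using (_≡_; _≢_; refl; trans; cong)

-- A 2-colored digraph on the vertex set V = Fin N.
-- adj u v ≡ true  means  uv ∈ E  (tail u, head v).
-- col v ≡ false   means  v ∈ U ;  col v ≡ true  means  v ∈ W.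
record ColDigraph (N : ℕ) : Set where
  field
    adj : Fin N → Fin N → Bool
    col : Fin N → Bool

module _ {N : ℕ} (G : ColDigraph N) where
  open ColDigraph G

  E : Fin N → Fin N → Set
  E u v = adj u v ≡ true

  InU InW : Fin N → Set
  InU v = col v ≡ false
  InW v = col v ≡ true

  USet WSet : Subset N
  USet = tabulate (not ∘ col)
  WSet = tabulate col

  Loopless : Set
  Loopless = ∀ v → ¬ E v v

  Bipartite : Set
  Bipartite = ∀ u v → E u v → col u ≢ col v

  Independent : Fin N → Fin N → Set
  Independent u v = ¬ E u v × ¬ E v u

  OutSub : Fin N → Fin N → Set
  OutSub u v = ∀ x → E u x → E v x

  N1 : Set
  N1 = ∀ u v w t → Independent u v → E u t → E v w → E t w → ⊥

  N2 : Set
  N2 = ∀ u v w t → E u v → E v w → E w t → E u t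

  N3 : Set
  N3 = ∀ u v → (∃[ w ] (E u w × E v w)) → OutSub u v ⊎ OutSub v u

  Is2qBMG : Set
  Is2qBMG = Loopless × Bipartite × N1 × N2 × N3

  Thin : Set
  Thin = ∀ x y → (∀ z → E x z ⇔ E y z) → (∀ z → E z x ⇔ E z y) → x ≡ y

  Balanced : Set
  Balanced = ∣ USet ∣ ≡ ∣ WSet ∣

  IsAutI : Permutation′ N → Set
  IsAutI π = (∀ x y → E x y → E (π ⟨$⟩ʳ x) (π ⟨$⟩ʳ y))
           × (∀ x → col (π ⟨$⟩ʳ x) ≡ col x)

  AutI : Set
  AutI = Σ (Permutation′ N) IsAutI

  _·ᴬ_ : AutI → AutI → AutI
  (π , e₁ , c₁) ·ᴬ (ρ , e₂ , c₂) =
    (π ∘ₚ ρ) , (λ x y exy → e₂ _ _ (e₁ x y exy)) , (λ x → trans (c₂ (π ⟨$⟩ʳ x)) (c₁ x))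

  IsOrbit : (Fin N → Set) → Set
  IsOrbit P = ∃[ x ] (∀ y → P y ⇔ (Σ AutI λ a → proj₁ a ⟨$⟩ʳ x ≡ y))

  DisjointEdges : Set
  DisjointEdges = ∀ u v x y → E u v → E x y → ¬ (u ≡ x × v ≡ y) →
    (u ≢ x) × (u ≢ y) × (v ≢ x) × (v ≢ y)

  DisjointSymEdges : Set
  DisjointSymEdges = (∀ u v → E u v → E v u) ×
    (∀ u v x y → E u v → E x y →
      ((u ≡ x × v ≡ y) ⊎ (u ≡ y × v ≡ x)) ⊎ ((u ≢ x) × (u ≢ y) × (v ≢ x) × (v ≢ y)))

_≈ₚ_ : {n : ℕ} → Permutation′ n → Permutation′ n → Set
π ≈ₚ ρ = ∀ x → π ⟨$⟩ʳ x ≡ ρ ⟨$⟩ʳ x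

record AutI≅Sym {N : ℕ} (G : ColDigraph N) (n : ℕ) : Set where
  field
    to   : AutI G → Permutation′ n
    from : Permutation′ n → AutI G
    to-from : ∀ σ → to (from σ) ≈ₚ σ
    from-to : ∀ a → proj₁ (from (to a)) ≈ₚ proj₁ a
    to-cong : ∀ a b → proj₁ a ≈ₚ proj₁ b → to a ≈ₚ to b
    from-cong : ∀ σ τ → σ ≈ₚ τ → proj₁ (from σ) ≈ₚ proj₁ (from τ)
    to-hom  : ∀ a b → to (_·ᴬ_ G a b) ≈ₚ (to a ∘ₚ to b)

{-# OPTIONS --safe #-}
module Submission where

-- An edge-preserving permutation of a finite digraph also reflects edges (compare the numbers of
-- edges), so Aut_I is a group acting transitively on each colour class; in particular vertices of
-- one colour have equal out-degree, and (N3) upgrades a common out-neighbour to equal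
-- out-neighbourhoods.  Fix an edge x₀ ⟶ y₀.  If x₀ has an in-neighbour, then every vertex has in-
-- and out-neighbours and (N2) makes every edge symmetric; otherwise every edge leaves the colour of
-- x₀.  Either way thinness leaves each vertex a single neighbour, so E is a perfect matching between
-- U and W oriented according to colour.  An automorphism is then determined by the permutation it
-- induces on the n matching edges, and every such permutation lifts, giving Aut_I ≅ Sym_n.

open import Defs
open import Data.Bool using (Bool; true; false; not; _xor_)
import Data.Bool as Bool
open import Data.Bool.Properties using (¬-not; not-¬; not-involutive; not-injective; xor-same; xor-identityʳ)
open import Data.Empty using (⊥-elim)
open import Data.Fin using (Fin; zero; suc)
import Data.Fin as Fin
open import Data.Fin.Permutation using (Permutation′; permutation; _⟨$⟩ʳ_; _⟨$⟩ˡ_; inverseʳ; inverseˡ; flip)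
import Data.Fin.Permutation as Perm
open import Data.Fin.Properties using (any?)
open import Data.Fin.Subset using (Subset; _∈_; ∣_∣; inside; outside)
open import Data.Nat using (ℕ; zero; suc; _+_; _≤_; z≤n)
open import Data.Nat.Properties
  using (≤-refl; ≤-trans; ≤-reflexive; ≤-antisym; +-mono-≤; +-monoʳ-≤; +-cancelʳ-≤; +-cancelˡ-≡; +-0-commutativeMonoid)
open import Algebra.Properties.CommutativeMonoid.Sum +-0-commutativeMonoid using (sum; sum-permute; sum-cong-≗)
open import Data.Product using (Σ; ∃; ∃₂; _×_; _,_; proj₁; proj₂; map₂)
open import Data.Sum using (_⊎_; inj₁; inj₂; swap)
open import Data.Unit using (⊤; tt)
open import Data.Vec using (_∷_; []; here; there)
open import Data.Vec.Properties using (lookup∘tabulate; []=⇒lookup; lookup⇒[]=)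
open import Function using (_∘_; Equivalence; _⇔_; mk⇔)
open import Relation.Binary using (Decidable)
open import Relation.Binary.PropositionalEquality
open import Relation.Nullary using (¬_; yes; no)

indicator : Bool → ℕ
indicator true = 1
indicator false = 0

indicator-mono : ∀ {a b} → (a ≡ true → b ≡ true) → indicator a ≤ indicator b
indicator-mono {true} a⇒b rewrite a⇒b refl = ≤-refl
indicator-mono {false} _ = z≤n

indicator-injective : ∀ {a b} → indicator a ≡ indicator b → a ≡ b
indicator-injective {true} {true} _ = refl
indicator-injective {false} {false} _ = refl

count : ∀ {N} → (Fin N → Bool) → ℕ
count p = sum λ x → indicator (p x)

sum-mono-≤ : ∀ {N} {f g : Fin N → ℕ} → (∀ x → f x ≤ g x) → sum f ≤ sum g
sum-mono-≤ {zero} f≤g = z≤n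
sum-mono-≤ {suc N} f≤g = +-mono-≤ (f≤g zero) (sum-mono-≤ (λ x → f≤g (suc x)))

≤-pointwise∧sum-≡⇒≗ : ∀ {N} {f g : Fin N → ℕ} → (∀ x → f x ≤ g x) → sum f ≡ sum g → f ≗ g
≤-pointwise∧sum-≡⇒≗ {suc N} {f} {g} f≤g Σf≡Σg = pointwise
  where
  tail≤ : sum (λ x → f (suc x)) ≤ sum (λ x → g (suc x))
  tail≤ = sum-mono-≤ (λ x → f≤g (suc x))
  head≡ : f zero ≡ g zero
  head≡ = ≤-antisym (f≤g zero)
    (+-cancelʳ-≤ _ (g zero) (f zero) (≤-trans (+-monoʳ-≤ (g zero) tail≤) (≤-reflexive (sym Σf≡Σg))))
  pointwise : ∀ x → f x ≡ g x
  pointwise zero = head≡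
  pointwise (suc x) = ≤-pointwise∧sum-≡⇒≗ (λ x → f≤g (suc x))
    (+-cancelˡ-≡ (f zero) _ _ (trans Σf≡Σg (cong (_+ _) (sym head≡)))) x

module _ {N : ℕ} {p q : Fin N → Bool} (p⊆q : ∀ x → p x ≡ true → q x ≡ true) where

  count-mono : count p ≤ count q
  count-mono = sum-mono-≤ (λ x → indicator-mono (p⊆q x))

  count-≡⇒⊇ : count p ≡ count q → ∀ x → q x ≡ true → p x ≡ true
  count-≡⇒⊇ eq x qx = trans (indicator-injective (≤-pointwise∧sum-≡⇒≗ (λ y → indicator-mono (p⊆q y)) eq x)) qx

count-permute : ∀ {N} (p : Fin N → Bool) (π : Permutation′ N) → count p ≡ count (λ x → p (π ⟨$⟩ʳ x))
count-permute p π = sum-permute (λ x → indicator (p x)) π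

module _ {N : ℕ} (R : Fin N → Fin N → Bool) (π : Permutation′ N)
         (preserves : ∀ x y → R x y ≡ true → R (π ⟨$⟩ʳ x) (π ⟨$⟩ʳ y) ≡ true) where

  private
    image-row : Fin N → Fin N → Bool
    image-row x y = R (π ⟨$⟩ʳ x) (π ⟨$⟩ʳ y)

  -- Pointwise ≤ holds by preservation; the totals agree after reindexing both sums along π.
  count-row≡count-image-row : ∀ x → count (R x) ≡ count (image-row x)
  count-row≡count-image-row = ≤-pointwise∧sum-≡⇒≗ (λ x → count-mono (preserves x)) (begin
    sum (λ x → count (R x))                 ≡⟨ sum-permute (λ x → count (R x)) π ⟩
    sum (λ x → count (R (π ⟨$⟩ʳ x)))        ≡⟨ sum-cong-≗ (λ x → count-permute (R (π ⟨$⟩ʳ x)) π) ⟩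
    sum (λ x → count (image-row x))         ∎)
    where open ≡-Reasoning

  preserves⇒reflects : ∀ x y → R (π ⟨$⟩ʳ x) (π ⟨$⟩ʳ y) ≡ true → R x y ≡ true
  preserves⇒reflects x = count-≡⇒⊇ (preserves x) (count-row≡count-image-row x)

  preserves⇒count-row-invariant : ∀ x → count (R (π ⟨$⟩ʳ x)) ≡ count (R x)
  preserves⇒count-row-invariant x =
    trans (count-permute (R (π ⟨$⟩ʳ x)) π) (sym (count-row≡count-image-row x))

record Enumeration {N : ℕ} (P : Fin N → Set) (n : ℕ) : Set where
  field
    element : Fin n → Fin N
    element∈ : ∀ i → P (element i)
    index : ∀ v → P v → Fin n
    element-index : ∀ v (p : P v) → element (index v p) ≡ v
    index-element : ∀ i (p : P (element i)) → index (element i) p ≡ i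

  index-≡ : ∀ {v i} → v ≡ element i → (p : P v) → index v p ≡ i
  index-≡ {i = i} refl = index-element i

enumerate : ∀ {N} (s : Subset N) → Enumeration (_∈ s) ∣ s ∣
enumerate [] = record
  { element = λ () ; element∈ = λ () ; index = λ () ; element-index = λ () ; index-element = λ () }
enumerate (inside ∷ s) = record
  { element = element′ ; element∈ = element∈′ ; index = index′
  ; element-index = element-index′ ; index-element = index-element′ }
  where
  open Enumeration (enumerate s)
  element′ : Fin (suc ∣ s ∣) → Fin _
  element′ zero = zero
  element′ (suc i) = suc (element i)
  element∈′ : ∀ i → element′ i ∈ inside ∷ s
  element∈′ zero = here
  element∈′ (suc i) = there (element∈ i)
  index′ : ∀ v → v ∈ inside ∷ s → Fin (suc ∣ s ∣)
  index′ zero _ = zero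
  index′ (suc v) (there v∈s) = suc (index v v∈s)
  element-index′ : ∀ v (v∈ : v ∈ inside ∷ s) → element′ (index′ v v∈) ≡ v
  element-index′ zero _ = refl
  element-index′ (suc v) (there v∈s) = cong suc (element-index v v∈s)
  index-element′ : ∀ i (i∈ : element′ i ∈ inside ∷ s) → index′ (element′ i) i∈ ≡ i
  index-element′ zero _ = refl
  index-element′ (suc i) (there i∈s) = cong suc (index-element i i∈s)
enumerate (outside ∷ s) = record
  { element = λ i → suc (element i) ; element∈ = λ i → there (element∈ i) ; index = index′
  ; element-index = element-index′ ; index-element = λ i → λ { (there i∈s) → index-element i i∈s } }
  where
  open Enumeration (enumerate s)
  index′ : ∀ v → v ∈ outside ∷ s → Fin ∣ s ∣
  index′ (suc v) (there v∈s) = index v v∈s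
  element-index′ : ∀ v (v∈ : v ∈ outside ∷ s) → suc (element (index′ v v∈)) ≡ v
  element-index′ (suc v) (there v∈s) = cong suc (element-index v v∈s)

module _ {N : ℕ} (G : ColDigraph N) where
  open ColDigraph G

  ∈USet⇔InU : ∀ {v} → v ∈ USet G ⇔ InU G v
  ∈USet⇔InU {v} = mk⇔
    (λ v∈U → not-injective (trans (sym (lookup∘tabulate (not ∘ col) v)) ([]=⇒lookup v∈U)))
    (λ v∈U → lookup⇒[]= v (USet G) (trans (lookup∘tabulate (not ∘ col) v) (cong not v∈U)))

  enumerate-U : ∀ {n} → ∣ USet G ∣ ≡ n → Enumeration (InU G) n
  enumerate-U refl = record
    { element = element
    ; element∈ = λ i → Equivalence.to ∈USet⇔InU (element∈ i)
    ; index = λ v → index v ∘ Equivalence.from ∈USet⇔InU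
    ; element-index = λ v _ → element-index v _
    ; index-element = λ i _ → index-element i _
    }
    where open Enumeration (enumerate (USet G))

module Automorphisms {N : ℕ} (G : ColDigraph N) where
  open ColDigraph G

  infix 4 _⟶_
  _⟶_ : Fin N → Fin N → Set
  _⟶_ = E G

  ⟦_⟧ : AutI G → Fin N → Fin N
  ⟦ a ⟧ v = proj₁ a ⟨$⟩ʳ v

  aut-preserves : (a : AutI G) → ∀ {x y} → x ⟶ y → ⟦ a ⟧ x ⟶ ⟦ a ⟧ y
  aut-preserves (_ , preserves , _) = preserves _ _

  aut-reflects : (a : AutI G) → ∀ {x y} → ⟦ a ⟧ x ⟶ ⟦ a ⟧ y → x ⟶ y
  aut-reflects (π , preserves , _) = preserves⇒reflects adj π preserves _ _

  aut-col : (a : AutI G) → ∀ v → col (⟦ a ⟧ v) ≡ col v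
  aut-col (_ , _ , preserves-col) = preserves-col

  _⁻¹ᴬ : AutI G → AutI G
  a ⁻¹ᴬ = flip π , preserves⁻¹ , preserves-col⁻¹
    where
    π = proj₁ a
    preserves⁻¹ : ∀ x y → x ⟶ y → flip π ⟨$⟩ʳ x ⟶ flip π ⟨$⟩ʳ y
    preserves⁻¹ x y x⟶y = aut-reflects a (subst₂ _⟶_ (sym (inverseʳ π)) (sym (inverseʳ π)) x⟶y)
    preserves-col⁻¹ : ∀ x → col (flip π ⟨$⟩ʳ x) ≡ col x
    preserves-col⁻¹ x = trans (sym (aut-col a (flip π ⟨$⟩ʳ x))) (cong col (inverseʳ π))

  ⟦⁻¹⟧-cancel : (a : AutI G) → ∀ v → ⟦ a ⁻¹ᴬ ⟧ (⟦ a ⟧ v) ≡ v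
  ⟦⁻¹⟧-cancel a _ = inverseˡ (proj₁ a)

  outdeg : Fin N → ℕ
  outdeg v = count (adj v)

  outdeg-invariant : (a : AutI G) → ∀ v → outdeg (⟦ a ⟧ v) ≡ outdeg v
  outdeg-invariant (π , preserves , _) = preserves⇒count-row-invariant adj π preserves

  idᴬ : AutI G
  idᴬ = Perm.id , (λ _ _ x⟶y → x⟶y) , (λ _ → refl)

  orbit-representative : ∀ {P} (o : IsOrbit G P) → P (proj₁ o)
  orbit-representative (x , reaches) = Equivalence.from (reaches x) (idᴬ , refl)

  orbit-transitive : ∀ {P} → IsOrbit G P → ∀ {y y′} → P y → P y′ → Σ (AutI G) λ a → ⟦ a ⟧ y ≡ y′
  orbit-transitive (x , reaches) {y} {y′} Py Py′
    with Equivalence.to (reaches y) Py | Equivalence.to (reaches y′) Py′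
  ... | a , ax≡y | a′ , a′x≡y′ = _·ᴬ_ G (a ⁻¹ᴬ) a′ , (begin
    ⟦ a′ ⟧ (⟦ a ⁻¹ᴬ ⟧ y)           ≡⟨ cong (λ v → ⟦ a′ ⟧ (⟦ a ⁻¹ᴬ ⟧ v)) (sym ax≡y) ⟩
    ⟦ a′ ⟧ (⟦ a ⁻¹ᴬ ⟧ (⟦ a ⟧ x))  ≡⟨ cong ⟦ a′ ⟧ (⟦⁻¹⟧-cancel a x) ⟩
    ⟦ a′ ⟧ x                      ≡⟨ a′x≡y′ ⟩
    y′                            ∎)
    where open ≡-Reasoning

  ColourTransitive : Set
  ColourTransitive = ∀ {y y′} → col y ≡ col y′ → Σ (AutI G) λ a → ⟦ a ⟧ y ≡ y′

  orbits⇒colour-transitive : IsOrbit G (InU G) → IsOrbit G (InW G) → ColourTransitive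
  orbits⇒colour-transitive orbitU orbitW {y′ = y′} same with col y′ in eq
  ... | false = orbit-transitive orbitU same eq
  ... | true = orbit-transitive orbitW same eq

data Orientation : Set where
  from-colour : Bool → Orientation
  both-ways : Orientation

Emits : Orientation → Bool → Set
Emits (from-colour c) b = b ≡ c
Emits both-ways _ = ⊤

record OrientedMatching {N : ℕ} (G : ColDigraph N) : Set where
  open ColDigraph G
  field
    partner : Fin N → Fin N
    partner-involutive : ∀ v → partner (partner v) ≡ v
    col-partner : ∀ v → col (partner v) ≡ not (col v)
    orientation : Orientation
    edge⇔ : ∀ x y → E G x y ⇔ (Emits orientation (col x) × y ≡ partner x)

module Structure {N : ℕ} {G : ColDigraph N} (bip : Bipartite G) (n2 : N2 G) (n3 : N3 G)
                 (thin : Thin G) (transitive : Automorphisms.ColourTransitive G) where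
  open ColDigraph G
  open Automorphisms G

  Adjacent : Fin N → Fin N → Set
  Adjacent x y = x ⟶ y ⊎ y ⟶ x

  tail-col : ∀ {x y} → x ⟶ y → col x ≡ not (col y)
  tail-col x⟶y = ¬-not (bip _ _ x⟶y)

  head-col : ∀ {x y} → x ⟶ y → col y ≡ not (col x)
  head-col x⟶y = ¬-not λ eq → bip _ _ x⟶y (sym eq)

  adjacent-col : ∀ {x y} → Adjacent x y → col y ≡ not (col x)
  adjacent-col (inj₁ x⟶y) = head-col x⟶y
  adjacent-col (inj₂ y⟶x) = tail-col y⟶x

  equal-neighbourhoods⇒≡ : ∀ {x y} → OutSub G x y → OutSub G y x
    → (∀ z → z ⟶ x → z ⟶ y) → (∀ z → z ⟶ y → z ⟶ x) → x ≡ y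
  equal-neighbourhoods⇒≡ x⊆y y⊆x x⊆y⁻ y⊆x⁻ =
    thin _ _ (λ z → mk⇔ (x⊆y z) (y⊆x z)) (λ z → mk⇔ (x⊆y⁻ z) (y⊆x⁻ z))

  equal-outdeg : ∀ {u u′} → col u ≡ col u′ → outdeg u ≡ outdeg u′
  equal-outdeg same with transitive same
  ... | a , au≡u′ = trans (sym (outdeg-invariant a _)) (cong outdeg au≡u′)

  -- N3 gives one inclusion; equal out-degrees force the other.
  common-out-neighbour⇒same-out : ∀ {u u′ w} → col u ≡ col u′ → u ⟶ w → u′ ⟶ w → OutSub G u u′
  common-out-neighbour⇒same-out {u} {u′} {w} same u⟶w u′⟶w with n3 u u′ (w , u⟶w , u′⟶w)
  ... | inj₁ u⊆u′ = u⊆u′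
  ... | inj₂ u′⊆u = count-≡⇒⊇ u′⊆u (equal-outdeg (sym same))

  out-neighbour-transfer : ∀ {y y′} → col y ≡ col y′ → ∃ (y ⟶_) → ∃ (y′ ⟶_)
  out-neighbour-transfer same (t , y⟶t) with transitive same
  ... | a , ay≡y′ = ⟦ a ⟧ t , subst (_⟶ ⟦ a ⟧ t) ay≡y′ (aut-preserves a y⟶t)

  in-neighbour-transfer : ∀ {y y′} → col y ≡ col y′ → ∃ (_⟶ y) → ∃ (_⟶ y′)
  in-neighbour-transfer same (z , z⟶y) with transitive same
  ... | a , ay≡y′ = ⟦ a ⟧ z , subst (⟦ a ⟧ z ⟶_) ay≡y′ (aut-preserves a z⟶y)

  module _ (o : Orientation) (neighbour : ∀ v → ∃ (Adjacent v))
           (adjacent-unique : ∀ {v y y′} → Adjacent v y → Adjacent v y′ → y ≡ y′)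
           (edge⇒emits : ∀ {x y} → x ⟶ y → Emits o (col x))
           (emits⇒edge : ∀ {x y} → Emits o (col x) → Adjacent x y → x ⟶ y) where

    matching : OrientedMatching G
    matching = record
      { partner = partner
      ; partner-involutive = λ v → sym (adjacent-unique (swap (adjacent v)) (adjacent (partner v)))
      ; col-partner = λ v → adjacent-col (adjacent v)
      ; orientation = o
      ; edge⇔ = λ x y → mk⇔
          (λ x⟶y → edge⇒emits x⟶y , adjacent-unique (inj₁ x⟶y) (adjacent x))
          (λ { (emits , refl) → emits⇒edge emits (adjacent x) })
      }
      where
      partner : Fin N → Fin N
      partner v = proj₁ (neighbour v)
      adjacent : ∀ v → Adjacent v (partner v)
      adjacent v = proj₂ (neighbour v)

  module OneWay {x₀ y₀ : Fin N} (x₀⟶y₀ : x₀ ⟶ y₀) (source : ∀ z → ¬ z ⟶ x₀) where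

    c : Bool
    c = col x₀

    head≁x₀ : ∀ {z y} → z ⟶ y → col y ≢ c
    head≁x₀ z⟶y y∼x₀ = source _ (proj₂ (in-neighbour-transfer y∼x₀ (_ , z⟶y)))

    tail∼x₀ : ∀ {x y} → x ⟶ y → col x ≡ c
    tail∼x₀ x⟶y = trans (tail-col x⟶y) (trans (cong not (¬-not (head≁x₀ x⟶y))) (not-involutive c))

    in-unique : ∀ {u u′ w} → u ⟶ w → u′ ⟶ w → u ≡ u′
    in-unique u⟶w u′⟶w = equal-neighbourhoods⇒≡
      (common-out-neighbour⇒same-out same u⟶w u′⟶w) (common-out-neighbour⇒same-out (sym same) u′⟶w u⟶w)
      (λ z z⟶u → ⊥-elim (head≁x₀ z⟶u (tail∼x₀ u⟶w)))
      (λ z z⟶u′ → ⊥-elim (head≁x₀ z⟶u′ (tail∼x₀ u′⟶w)))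
      where same = trans (tail∼x₀ u⟶w) (sym (tail∼x₀ u′⟶w))

    out-unique : ∀ {u v y} → u ⟶ v → u ⟶ y → v ≡ y
    out-unique u⟶v u⟶y = equal-neighbourhoods⇒≡
      (λ z v⟶z → ⊥-elim (head≁x₀ u⟶v (tail∼x₀ v⟶z)))
      (λ z y⟶z → ⊥-elim (head≁x₀ u⟶y (tail∼x₀ y⟶z)))
      (λ z z⟶v → subst (_⟶ _) (sym (in-unique z⟶v u⟶v)) u⟶y)
      (λ z z⟶y → subst (_⟶ _) (sym (in-unique z⟶y u⟶y)) u⟶v)

    adjacent-unique : ∀ {v y y′} → Adjacent v y → Adjacent v y′ → y ≡ y′
    adjacent-unique (inj₁ v⟶y) (inj₁ v⟶y′) = out-unique v⟶y v⟶y′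
    adjacent-unique (inj₂ y⟶v) (inj₂ y′⟶v) = in-unique y⟶v y′⟶v
    adjacent-unique (inj₁ v⟶y) (inj₂ y′⟶v) = ⊥-elim (head≁x₀ y′⟶v (tail∼x₀ v⟶y))
    adjacent-unique (inj₂ y⟶v) (inj₁ v⟶y′) = ⊥-elim (head≁x₀ y⟶v (tail∼x₀ v⟶y′))

    neighbour : ∀ v → ∃ (Adjacent v)
    neighbour v with col v Bool.≟ c
    ... | yes v∼x₀ = map₂ inj₁ (out-neighbour-transfer (sym v∼x₀) (y₀ , x₀⟶y₀))
    ... | no v≁x₀ = map₂ inj₂ (in-neighbour-transfer (trans (head-col x₀⟶y₀) (sym (¬-not v≁x₀))) (x₀ , x₀⟶y₀))

    adjacent⇒edge : ∀ {x y} → col x ≡ c → Adjacent x y → x ⟶ y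
    adjacent⇒edge _ (inj₁ x⟶y) = x⟶y
    adjacent⇒edge x∼x₀ (inj₂ y⟶x) = ⊥-elim (head≁x₀ y⟶x x∼x₀)

    oriented-matching : OrientedMatching G
    oriented-matching = matching (from-colour c) neighbour adjacent-unique tail∼x₀ adjacent⇒edge

  module TwoWay {z₀ x₀ y₀ : Fin N} (z₀⟶x₀ : z₀ ⟶ x₀) (x₀⟶y₀ : x₀ ⟶ y₀) where

    has-out : ∀ v → ∃ (v ⟶_)
    has-out v with col v Bool.≟ col x₀
    ... | yes v∼x₀ = out-neighbour-transfer (sym v∼x₀) (y₀ , x₀⟶y₀)
    ... | no v≁x₀ = out-neighbour-transfer (trans (tail-col z₀⟶x₀) (sym (¬-not v≁x₀))) (x₀ , z₀⟶x₀)

    has-in : ∀ v → ∃ (_⟶ v)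
    has-in v with col v Bool.≟ col x₀
    ... | yes v∼x₀ = in-neighbour-transfer (sym v∼x₀) (z₀ , z₀⟶x₀)
    ... | no v≁x₀ = in-neighbour-transfer (trans (head-col x₀⟶y₀) (sym (¬-not v≁x₀))) (x₀ , x₀⟶y₀)

    -- For z ⟶ u ⟶ w ⟶ t, N2 gives z ⟶ t, so z and w share the out-neighbour t and hence u.
    symmetric : ∀ {u w} → u ⟶ w → w ⟶ u
    symmetric {u} {w} u⟶w with has-in u | has-out w
    ... | z , z⟶u | t , w⟶t =
      common-out-neighbour⇒same-out z∼w (n2 z u w t z⟶u u⟶w w⟶t) w⟶t u z⟶u
      where z∼w = trans (tail-col z⟶u) (sym (head-col u⟶w))

    out-unique : ∀ {a b c} → a ⟶ b → a ⟶ c → b ≡ c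
    out-unique a⟶b a⟶c = equal-neighbourhoods⇒≡ b⊆c c⊆b
      (λ z z⟶b → symmetric (b⊆c z (symmetric z⟶b)))
      (λ z z⟶c → symmetric (c⊆b z (symmetric z⟶c)))
      where
      b∼c = trans (head-col a⟶b) (sym (head-col a⟶c))
      b⊆c = common-out-neighbour⇒same-out b∼c (symmetric a⟶b) (symmetric a⟶c)
      c⊆b = common-out-neighbour⇒same-out (sym b∼c) (symmetric a⟶c) (symmetric a⟶b)

    adjacent⇒edge : ∀ {x y} → Adjacent x y → x ⟶ y
    adjacent⇒edge (inj₁ x⟶y) = x⟶y
    adjacent⇒edge (inj₂ y⟶x) = symmetric y⟶x

    oriented-matching : OrientedMatching G
    oriented-matching = matching both-ways (λ v → map₂ inj₁ (has-out v))
      (λ a a′ → out-unique (adjacent⇒edge a) (adjacent⇒edge a′)) (λ _ → tt) (λ _ → adjacent⇒edge)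

  _⟶?_ : Decidable _⟶_
  x ⟶? y = adj x y Bool.≟ true

  some-edge : ∀ {u w} → col u ≢ col w → ∃₂ _⟶_
  some-edge u≁w with any? (λ x → any? (x ⟶?_))
  ... | yes edge = edge
  ... | no edgeless = ⊥-elim (u≁w (cong col (thin _ _ (λ _ → mk⇔ none none) (λ _ → mk⇔ none none))))
    where
    none : ∀ {a b x y} → a ⟶ b → x ⟶ y
    none a⟶b = ⊥-elim (edgeless (_ , _ , a⟶b))

  oriented-matching : ∀ {u w} → col u ≢ col w → OrientedMatching G
  oriented-matching u≁w with some-edge u≁w
  ... | x₀ , y₀ , x₀⟶y₀ with any? (_⟶? x₀)
  ...   | yes (z₀ , z₀⟶x₀) = TwoWay.oriented-matching z₀⟶x₀ x₀⟶y₀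
  ...   | no unentered = OneWay.oriented-matching x₀⟶y₀ (λ z z⟶x₀ → unentered (z , z⟶x₀))

module MatchingFacts {N : ℕ} {G : ColDigraph N} (M : OrientedMatching G) where
  open ColDigraph G
  open Automorphisms G
  open OrientedMatching M

  emits : ∀ {x y} → x ⟶ y → Emits orientation (col x)
  emits {x} {y} x⟶y = proj₁ (Equivalence.to (edge⇔ x y) x⟶y)

  partner-unique : ∀ {x y} → x ⟶ y → y ≡ partner x
  partner-unique {x} {y} x⟶y = proj₂ (Equivalence.to (edge⇔ x y) x⟶y)

  emits⇒edge : ∀ {x} → Emits orientation (col x) → x ⟶ partner x
  emits⇒edge {x} em = Equivalence.from (edge⇔ x (partner x)) (em , refl)

  partner-flip : ∀ {x y} → y ≡ partner x → x ≡ partner y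
  partner-flip refl = sym (partner-involutive _)

  out-unique : ∀ {x y y′} → x ⟶ y → x ⟶ y′ → y ≡ y′
  out-unique x⟶y x⟶y′ = trans (partner-unique x⟶y) (sym (partner-unique x⟶y′))

  in-unique : ∀ {x x′ y} → x ⟶ y → x′ ⟶ y → x ≡ x′
  in-unique x⟶y x′⟶y = trans (partner-flip (partner-unique x⟶y)) (sym (partner-flip (partner-unique x′⟶y)))

  emits-either : ∀ b → Emits orientation b ⊎ Emits orientation (not b)
  emits-either b with orientation
  ... | both-ways = inj₁ tt
  ... | from-colour c with b Bool.≟ c
  ...   | yes b≡c = inj₁ b≡c
  ...   | no b≢c = inj₂ (trans (cong not (¬-not b≢c)) (not-involutive c))

  matched : ∀ v → v ⟶ partner v ⊎ partner v ⟶ v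
  matched v with emits-either (col v)
  ... | inj₁ em = inj₁ (emits⇒edge em)
  ... | inj₂ em = inj₂ (subst (partner v ⟶_) (partner-involutive v)
                          (emits⇒edge (subst (Emits orientation) (sym (col-partner v)) em)))

  aut-partner : (a : AutI G) → ∀ v → ⟦ a ⟧ (partner v) ≡ partner (⟦ a ⟧ v)
  aut-partner a v with matched v
  ... | inj₁ v⟶pv = partner-unique (aut-preserves a v⟶pv)
  ... | inj₂ pv⟶v = partner-flip (partner-unique (aut-preserves a pv⟶v))

  one-way⇒disjoint : ∀ {c} → (∀ {x y} → x ⟶ y → col x ≡ c) → DisjointEdges G
  one-way⇒disjoint {c} tail∼c u v x y u⟶v x⟶y not-same =
    u≢x , tail≢head u⟶v x⟶y , (λ v≡x → tail≢head x⟶y u⟶v (sym v≡x)) , v≢y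
    where
    u≢x : u ≢ x
    u≢x refl = not-same (refl , out-unique u⟶v x⟶y)
    v≢y : v ≢ y
    v≢y refl = not-same (in-unique u⟶v x⟶y , refl)
    tail≢head : ∀ {a b a′ b′} → a ⟶ b → a′ ⟶ b′ → a ≢ b′
    tail≢head {a} {a′ = a′} a⟶b a′⟶b′ refl = not-¬ (tail∼c a⟶b)
      (begin
        col a            ≡⟨ cong col (partner-unique a′⟶b′) ⟩
        col (partner a′) ≡⟨ col-partner a′ ⟩
        not (col a′)     ≡⟨ cong not (tail∼c a′⟶b′) ⟩
        not c            ∎)
      where open ≡-Reasoning

  symmetric⇒disjoint-symmetric : (∀ {x y} → x ⟶ y → y ⟶ x) → DisjointSymEdges G
  symmetric⇒disjoint-symmetric symmetric = (λ _ _ → symmetric) , disjoint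
    where
    disjoint : ∀ u v x y → u ⟶ v → x ⟶ y →
      ((u ≡ x × v ≡ y) ⊎ (u ≡ y × v ≡ x)) ⊎ ((u ≢ x) × (u ≢ y) × (v ≢ x) × (v ≢ y))
    disjoint u v x y u⟶v x⟶y with u Fin.≟ x | u Fin.≟ y
    ... | yes refl | _ = inj₁ (inj₁ (refl , out-unique u⟶v x⟶y))
    ... | no _ | yes refl = inj₁ (inj₂ (refl , out-unique u⟶v (symmetric x⟶y)))
    ... | no u≢x | no u≢y = inj₂ (u≢x , u≢y , v≢x , v≢y)
      where
      v≢x : v ≢ x
      v≢x refl = u≢y (out-unique (symmetric u⟶v) x⟶y)
      v≢y : v ≢ y
      v≢y refl = u≢x (out-unique (symmetric u⟶v) (symmetric x⟶y))

  disjoint-edges : DisjointEdges G ⊎ DisjointSymEdges G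
  disjoint-edges = by-orientation orientation emits emits⇒edge
    where
    by-orientation : (o : Orientation) → (∀ {x y} → x ⟶ y → Emits o (col x))
      → (∀ {x} → Emits o (col x) → x ⟶ partner x) → DisjointEdges G ⊎ DisjointSymEdges G
    by-orientation (from-colour c) emits _ = inj₁ (one-way⇒disjoint emits)
    by-orientation both-ways _ emits⇒edge = inj₂ (symmetric⇒disjoint-symmetric λ {x} {y} x⟶y →
      subst (y ⟶_) (sym (partner-flip (partner-unique x⟶y))) (emits⇒edge tt))

module Symmetries {N : ℕ} {G : ColDigraph N} (M : OrientedMatching G) {n : ℕ} (U : Enumeration (InU G) n) where
  open ColDigraph G
  open Automorphisms G
  open OrientedMatching M
  open MatchingFacts M
  open Enumeration U

  partner^ : Bool → Fin N → Fin N
  partner^ false v = v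
  partner^ true v = partner v

  col-partner^ : ∀ b v → col (partner^ b v) ≡ b xor col v
  col-partner^ false v = refl
  col-partner^ true v = col-partner v

  partner^-involutive : ∀ b v → partner^ b (partner^ b v) ≡ v
  partner^-involutive false v = refl
  partner^-involutive true v = partner-involutive v

  partner-partner^ : ∀ b v → partner (partner^ b v) ≡ partner^ (not b) v
  partner-partner^ false v = refl
  partner-partner^ true v = partner-involutive v

  aut-partner^ : (a : AutI G) → ∀ b v → ⟦ a ⟧ (partner^ b v) ≡ partner^ b (⟦ a ⟧ v)
  aut-partner^ a false v = refl
  aut-partner^ a true v = aut-partner a v

  -- A vertex v has coordinates (edge-of v , col v): the index of its matching edge in the
  -- enumeration of U, and its colour.
  edge-of : Fin N → Fin n
  edge-of v = index (partner^ (col v) v) (trans (col-partner^ (col v) v) (xor-same (col v)))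

  endpoint : Fin n → Bool → Fin N
  endpoint i b = partner^ b (element i)

  col-endpoint : ∀ i b → col (endpoint i b) ≡ b
  col-endpoint i b = trans (col-partner^ b (element i)) (trans (cong (b xor_) (element∈ i)) (xor-identityʳ b))

  edge-of-endpoint : ∀ i b → edge-of (endpoint i b) ≡ i
  edge-of-endpoint i b = index-≡
    (trans (cong (λ c → partner^ c (endpoint i b)) (col-endpoint i b)) (partner^-involutive b (element i))) _

  endpoint-edge-of : ∀ v → endpoint (edge-of v) (col v) ≡ v
  endpoint-edge-of v = trans (cong (partner^ (col v)) (element-index _ _)) (partner^-involutive (col v) v)

  edge-of-partner : ∀ v → edge-of (partner v) ≡ edge-of v
  edge-of-partner v = begin
    edge-of (partner v)                               ≡⟨ cong (edge-of ∘ partner) (sym (endpoint-edge-of v)) ⟩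
    edge-of (partner (endpoint (edge-of v) (col v)))  ≡⟨ cong edge-of (partner-partner^ (col v) _) ⟩
    edge-of (endpoint (edge-of v) (not (col v)))      ≡⟨ edge-of-endpoint (edge-of v) (not (col v)) ⟩
    edge-of v                                         ∎
    where open ≡-Reasoning

  edge-of-partner^ : ∀ b v → edge-of (partner^ b v) ≡ edge-of v
  edge-of-partner^ false v = refl
  edge-of-partner^ true v = edge-of-partner v

  lift : (Fin n → Fin n) → Fin N → Fin N
  lift s v = endpoint (s (edge-of v)) (col v)

  col-lift : ∀ s v → col (lift s v) ≡ col v
  col-lift s v = col-endpoint (s (edge-of v)) (col v)

  edge-of-lift : ∀ s v → edge-of (lift s v) ≡ s (edge-of v)
  edge-of-lift s v = edge-of-endpoint (s (edge-of v)) (col v)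

  lift-partner : ∀ s v → lift s (partner v) ≡ partner (lift s v)
  lift-partner s v = begin
    endpoint (s (edge-of (partner v))) (col (partner v))  ≡⟨ cong₂ endpoint (cong s (edge-of-partner v)) (col-partner v) ⟩
    endpoint (s (edge-of v)) (not (col v))                ≡⟨ sym (partner-partner^ (col v) _) ⟩
    partner (lift s v)                                    ∎
    where open ≡-Reasoning

  lift-preserves : ∀ s {x y} → x ⟶ y → lift s x ⟶ lift s y
  lift-preserves s {x} x⟶y = Equivalence.from (edge⇔ _ _)
    ( subst (Emits orientation) (sym (col-lift s x)) (emits x⟶y)
    , trans (cong (lift s) (partner-unique x⟶y)) (lift-partner s x))

  lift-inverse : ∀ s t → (∀ i → t (s i) ≡ i) → ∀ v → lift t (lift s v) ≡ v
  lift-inverse s t t∘s≗id v = begin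
    endpoint (t (edge-of (lift s v))) (col (lift s v))  ≡⟨ cong₂ endpoint (cong t (edge-of-lift s v)) (col-lift s v) ⟩
    endpoint (t (s (edge-of v))) (col v)                 ≡⟨ cong (λ i → endpoint i (col v)) (t∘s≗id (edge-of v)) ⟩
    endpoint (edge-of v) (col v)                         ≡⟨ endpoint-edge-of v ⟩
    v                                                    ∎
    where open ≡-Reasoning

  liftᴬ : Permutation′ n → AutI G
  liftᴬ σ = permutation (lift (σ ⟨$⟩ʳ_)) (lift (σ ⟨$⟩ˡ_))
              (lift-inverse (σ ⟨$⟩ˡ_) (σ ⟨$⟩ʳ_) (λ _ → inverseʳ σ))
              (lift-inverse (σ ⟨$⟩ʳ_) (σ ⟨$⟩ˡ_) (λ _ → inverseˡ σ))
          , (λ _ _ → lift-preserves (σ ⟨$⟩ʳ_)) , col-lift (σ ⟨$⟩ʳ_)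

  restrict : AutI G → Fin n → Fin n
  restrict a i = edge-of (⟦ a ⟧ (element i))

  edge-of-aut : (a : AutI G) → ∀ v → edge-of (⟦ a ⟧ v) ≡ restrict a (edge-of v)
  edge-of-aut a v = begin
    edge-of (⟦ a ⟧ v)                                     ≡⟨ cong (edge-of ∘ ⟦ a ⟧) (sym (endpoint-edge-of v)) ⟩
    edge-of (⟦ a ⟧ (partner^ (col v) (element (edge-of v))))  ≡⟨ cong edge-of (aut-partner^ a (col v) _) ⟩
    edge-of (partner^ (col v) (⟦ a ⟧ (element (edge-of v))))  ≡⟨ edge-of-partner^ (col v) _ ⟩
    restrict a (edge-of v)                                ∎
    where open ≡-Reasoning

  restrict-inverse : ∀ a b → (∀ v → ⟦ b ⟧ (⟦ a ⟧ v) ≡ v) → ∀ i → restrict b (restrict a i) ≡ i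
  restrict-inverse a b b∘a≗id i = begin
    restrict b (edge-of (⟦ a ⟧ (element i)))  ≡⟨ sym (edge-of-aut b _) ⟩
    edge-of (⟦ b ⟧ (⟦ a ⟧ (element i)))       ≡⟨ cong edge-of (b∘a≗id (element i)) ⟩
    edge-of (element i)                       ≡⟨ edge-of-endpoint i false ⟩
    i                                         ∎
    where open ≡-Reasoning

  restrictᴾ : AutI G → Permutation′ n
  restrictᴾ a = permutation (restrict a) (restrict (a ⁻¹ᴬ))
    (restrict-inverse (a ⁻¹ᴬ) a (λ _ → inverseʳ (proj₁ a))) (restrict-inverse a (a ⁻¹ᴬ) (⟦⁻¹⟧-cancel a))

  AutI≅Symₙ : AutI≅Sym G n
  AutI≅Symₙ = record
    { to = restrictᴾ
    ; from = liftᴬ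
    ; to-from = λ σ i → trans (edge-of-lift (σ ⟨$⟩ʳ_) (element i)) (cong (σ ⟨$⟩ʳ_) (edge-of-endpoint i false))
    ; from-to = λ a v → trans (cong₂ endpoint (sym (edge-of-aut a v)) (sym (aut-col a v))) (endpoint-edge-of (⟦ a ⟧ v))
    ; to-cong = λ _ _ a≈b i → cong edge-of (a≈b (element i))
    ; from-cong = λ _ _ σ≈τ v → cong (λ i → endpoint i (col v)) (σ≈τ (edge-of v))
    ; to-hom = λ a b i → edge-of-aut b (⟦ a ⟧ (element i))
    }

proposition5p4 : (N : ℕ) (G : ColDigraph N) → Is2qBMG G → Thin G → Balanced G
    → IsOrbit G (InU G) → IsOrbit G (InW G)
    → (DisjointEdges G ⊎ DisjointSymEdges G)
    × ((n : ℕ) → ∣ USet G ∣ ≡ n → AutI≅Sym G n)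
proposition5p4 N G (_ , bip , _ , n2 , n3) thin _ orbitU orbitW =
  MatchingFacts.disjoint-edges M , λ n |U|≡n → Symmetries.AutI≅Symₙ M (enumerate-U G |U|≡n)
  where
  open ColDigraph G
  open Automorphisms G

  U≁W : col (proj₁ orbitU) ≢ col (proj₁ orbitW)
  U≁W eq with trans (sym (orbit-representative orbitU)) (trans eq (orbit-representative orbitW))
  ... | ()

  M : OrientedMatching G
  M = Structure.oriented-matching bip n2 n3 thin (orbits⇒colour-transitive orbitU orbitW) U≁W
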